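{- For $p\in\mathbb{N}_0$ and all $n\in\mathbb{N}$, $$H_n(-p,1,1)=H_n(-p)H_n(1,1)-C^{(p)}_{0}(n)H_n+C^{(p)}_{0,0}(n)=\tfrac12H_n(-p)\big(H_n^2-H_n(2)\big)-C^{(p)}_{0}(n)H_n+C^{(p)}_{0,0}(n).$$
   Context: For $n\in\mathbb{N}$ and $(k_1,\dots,k_r)\in\mathbb{Z}^r$, $H_n(k_1,\dots,k_r)=\sum_{n\ge n_1>\dots>n_r>0}n_1^{ -k_1}\cdots n_r^{ -k_r}$ (zero if $n<r$); $H_n=H_n(1)$, $H_n(-p)=\sum_{m=1}^nm^p$, and $H_n(-p,1,1)=\sum_{m=1}^nm^pH_{m-1}(1,1)$. Bernoulli numbers: $\frac{te^t}{e^t-1}=\sum_{j\ge0}B_j\frac{t^j}{j!}$. For $p\in\mathbb{N}_0$, $r\ge1$, $a_2,\dots,a_r\in\mathbb{N}_0$ and $a_1=0$, $$C^{(p)}_{a_2,\dots,a_r}(x)=\sum_{\substack{j_1,\dots,j_r\ge0\\ j_1+\dots+j_r\le p-a_r}}\Big(\prod_{i=1}^r\frac{\binom{p+1-a_i-j_1-\dots-j_{i-1}}{j_i}B_{j_i}}{p+1-a_i-j_1-\dots-j_{i-1}}\Big)x^{p+1-a_r-j_1-\dots-j_r}.$$ -}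

module Defs where

open import Data.Nat as ℕ using (ℕ; zero; suc; _∸_; _<ᵇ_)
open import Data.Nat.Combinatorics using (_C_)
open import Data.Integer as ℤ using (ℤ; +_; -[1+_])
open import Data.Rational as ℚ using (ℚ; 0ℚ; 1ℚ; _+_; _*_; _-_; _/_)
open import Data.List using (List; []; _∷_; _++_; [_]; upTo; map; foldr; zipWith; length)
open import Data.Bool using (if_then_else_)
open import Data.Product using (_×_; _,_)

ℕ→ℚ : ℕ → ℚ
ℕ→ℚ n = (+ n) / 1

-- 1/n for n ≥ 1 (value at 0 is irrelevant: never used at 0 below)
invℕ : ℕ → ℚ
invℕ zero    = 0ℚ
invℕ (suc k) = (+ 1) / suc k

_^ℚ_ : ℚ → ℕ → ℚ
x ^ℚ zero  = 1ℚ
x ^ℚ suc k = x * (x ^ℚ k)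

sumFrom : ℕ → ℕ → (ℕ → ℚ) → ℚ
sumFrom lo zero    f = 0ℚ
sumFrom lo (suc l) f = f lo + sumFrom (suc lo) l f

powNeg : ℕ → ℤ → ℚ
powNeg m (+ k)      = invℕ m ^ℚ k
powNeg m -[1+ k ]   = ℕ→ℚ m ^ℚ suc k

-- multiple harmonic sums H_n(k_1,...,k_r) = Σ_{n ≥ n_1 > ... > n_r > 0} n_1^{-k_1} ⋯ n_r^{-k_r}
-- (recursively: H_n() = 1, H_n(k_1,ks) = Σ_{m=1}^n m^{-k_1} H_{m-1}(ks); zero if n < r)
H : ℕ → List ℤ → ℚ
H n []       = 1ℚ
H n (k ∷ ks) = sumFrom 1 n (λ m → powNeg m k * H (m ∸ 1) ks)

-- Bernoulli numbers with te^t/(e^t-1) = Σ B_j t^j/j!  (so B_1 = +1/2).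
-- Comparing coefficients of t^{m+1} in (e^t - 1) Σ_j B_j t^j/j! = t e^t gives
--   Σ_{j=0}^{m} C(m+1,j) B_j = m+1,  which determines B_m recursively.
private
  indexed : List ℚ → List (ℕ × ℚ)
  indexed l = zipWith _,_ (upTo (length l)) l

  nextB : ℕ → List ℚ → ℚ
  nextB m bs = (ℕ→ℚ (suc m) - foldr (λ { (j , b) acc → ℕ→ℚ (suc m C j) * b + acc }) 0ℚ (indexed bs))
               * invℕ (suc m)

bernoulliList : ℕ → List ℚ
bernoulliList zero    = []
bernoulliList (suc m) = bernoulliList m ++ [ nextB m (bernoulliList m) ]

Bernoulli : ℕ → ℚ
Bernoulli m = nextB m (bernoulliList m)

-- C^{(p)}_{a_2,...,a_r}(x), with the list argument being [a_2,...,a_r] (a_1 = 0 is prepended).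
-- Sum over j_1..j_r ≥ 0 with j_1+...+j_r ≤ p - a_r (empty sum if p < a_r) of
--   Π_i binom(p+1-a_i-s_{i-1}, j_i) B_{j_i} / (p+1-a_i-s_{i-1})  ·  x^{p+1-a_r-s_r},
-- where s_i = j_1 + ... + j_i.
-- (For the instances a_i = 0 used below all quantities p+1-a_i-s are ≥ 1, so truncated
--  subtraction and invℕ are exact.)
private
  lastOr : ℕ → List ℕ → ℕ
  lastOr d []       = d
  lastOr d (a ∷ as) = lastOr a as

  -- go p N x as s : sum over the j's for the remaining a's, s = sum of previous j's,
  -- N = p - a_r is the bound on the total.
  go : ℕ → ℕ → ℚ → List ℕ → ℕ → ℚ
  go p N x []       s = 0ℚ
  go p N x (a ∷ []) s =
    sumFrom 0 (suc (N ∸ s)) (λ j →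
      ℕ→ℚ ((suc p ∸ a ∸ s) C j) * Bernoulli j * invℕ (suc p ∸ a ∸ s)
      * (x ^ℚ (suc p ∸ a ∸ s ∸ j)))
  go p N x (a ∷ b ∷ as) s =
    sumFrom 0 (suc (N ∸ s)) (λ j →
      ℕ→ℚ ((suc p ∸ a ∸ s) C j) * Bernoulli j * invℕ (suc p ∸ a ∸ s)
      * go p N x (b ∷ as) (s ℕ.+ j))

Cp : ℕ → List ℕ → ℚ → ℚ
Cp p as x with lastOr 0 as
... | ar = if p <ᵇ ar then 0ℚ else go p (p ∸ ar) x (0 ∷ as) 0

-- Faulhaber's polynomial S_q(x) = Σ_{j ≤ q} C(q+1,j) B_j x^{q+1-j}/(q+1) satisfies
-- S_q(x+1) = S_q(x) + (x+1)^q, a consequence of the shift identity of the Bernoulli polynomials,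
-- so H_n(-q) = S_q(n). Let (T f)_q = Σ_{j ≤ q} C(q+1,j) B_j/(q+1) f_{q-j}; then S = T (x ↦ x^{r+1}),
-- C^{(p)}_0 = (T S)_p and C^{(p)}_{0,0} = (T T S)_p. Writing the increment (n+1)^r of S_r as
-- (n+1)^{r+1}/(n+1), linearity of T gives (T S)_p(n+1) = (T S)_p(n) + S_p(n+1)/(n+1) and
-- (T T S)_p(n+1) = (T T S)_p(n) + (T S)_p(n+1)/(n+1). Both sides of the first identity then satisfy
-- the same recurrence in n; the second follows from H_n(1,1) = (H_n² - H_n(2))/2.

module Submission where

open import Defs
open import Data.Nat.Base as ℕ using (ℕ; zero; suc; _∸_; _≤_; _<_; _!)
import Data.Nat.Properties as ℕ
open import Data.Nat.Combinatorics
  using (_C_; nCn≡1; nC1≡n; nCk≡nC[n∸k]; k>n⇒nCk≡0; k![n∸k]!∣n!; nCk+nC[k+1]≡[n+1]C[k+1])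
open import Data.Nat.Combinatorics.Specification using (nCk≡n!/k![n-k]!)
open import Data.Nat.DivMod using (m/n*n≡m)
import Data.Nat.Coprimality as Coprime
open import Data.Integer.Base as ℤ using (+_; -_)
import Data.Integer.Properties as ℤ
open import Data.Rational.Base using (ℚ; mkℚ; 0ℚ; 1ℚ; _+_; _*_; _-_; _/_)
import Data.Rational.Properties as ℚ
open import Data.List.Base using (List; []; _∷_; _∷ʳ_; upTo; foldr; zipWith; length)
import Data.List.Properties as List
open import Data.Product.Base using (_×_; _,_)
open import Data.Sum.Base using (inj₁; inj₂)
open import Relation.Binary.PropositionalEquality
  using (_≡_; refl; sym; trans; cong; cong₂; subst; module ≡-Reasoning)
open import Relation.Nullary.Decidable using (dec⇒maybe)
open import Tactic.RingSolver using (solve-∀)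
import Data.Nat.Tactic.RingSolver as ℕ-Solver
open import Tactic.RingSolver.Core.AlmostCommutativeRing using (AlmostCommutativeRing; fromCommutativeRing)

open ≡-Reasoning

ℚ-ring : AlmostCommutativeRing _ _
ℚ-ring = fromCommutativeRing ℚ.+-*-commutativeRing (λ x → dec⇒maybe (0ℚ ℚ.≟ x))

ℕ→ℚ≡mkℚ : ∀ n → ℕ→ℚ n ≡ mkℚ (+ n) 0 (Coprime.sym (Coprime.1-coprimeTo n))
ℕ→ℚ≡mkℚ n = ℚ.normalize-coprime _

ℕ→ℚ-+ : ∀ m n → ℕ→ℚ (m ℕ.+ n) ≡ ℕ→ℚ m + ℕ→ℚ n
ℕ→ℚ-+ m n rewrite ℕ→ℚ≡mkℚ m | ℕ→ℚ≡mkℚ n =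
  ℚ./-cong {+ (m ℕ.+ n)} {1} {+ m ℤ.* + 1 ℤ.+ + n ℤ.* + 1} {1}
    (trans (ℤ.pos-+ m n) (cong₂ ℤ._+_ (sym (ℤ.*-identityʳ (+ m))) (sym (ℤ.*-identityʳ (+ n))))) refl

ℕ→ℚ-* : ∀ m n → ℕ→ℚ (m ℕ.* n) ≡ ℕ→ℚ m * ℕ→ℚ n
ℕ→ℚ-* m n rewrite ℕ→ℚ≡mkℚ m | ℕ→ℚ≡mkℚ n = ℚ./-cong {+ (m ℕ.* n)} {1} {+ m ℤ.* + n} {1} (ℤ.pos-* m n) refl

ℕ→ℚ-suc : ∀ n → ℕ→ℚ (suc n) ≡ ℕ→ℚ n + 1ℚ
ℕ→ℚ-suc n = trans (cong ℕ→ℚ (ℕ.+-comm 1 n)) (ℕ→ℚ-+ n 1)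

ℕ→ℚ*invℕ : ∀ n → ℕ→ℚ (suc n) * invℕ (suc n) ≡ 1ℚ
ℕ→ℚ*invℕ n rewrite ℕ→ℚ≡mkℚ (suc n) | ℚ.normalize-coprime (Coprime.1-coprimeTo (suc n)) =
  ℚ.*-inverseʳ (mkℚ (+ suc n) 0 (Coprime.sym (Coprime.1-coprimeTo (suc n))))

invℕ*[ℕ→ℚ*x] : ∀ n x → invℕ (suc n) * (ℕ→ℚ (suc n) * x) ≡ x
invℕ*[ℕ→ℚ*x] n x = begin
  i * (y * x) ≡⟨ reassoc i y x ⟩
  (y * i) * x ≡⟨ cong (_* x) (ℕ→ℚ*invℕ n) ⟩
  1ℚ * x      ≡⟨ ℚ.*-identityˡ x ⟩
  x           ∎
  where
  i = invℕ (suc n)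
  y = ℕ→ℚ (suc n)
  reassoc : ∀ i y x → i * (y * x) ≡ (y * i) * x
  reassoc = solve-∀ ℚ-ring

ℕ→ℚ[1+n]*-cancelˡ : ∀ n {a b} → ℕ→ℚ (suc n) * a ≡ ℕ→ℚ (suc n) * b → a ≡ b
ℕ→ℚ[1+n]*-cancelˡ n {a} {b} eq = begin
  a                                   ≡⟨ invℕ*[ℕ→ℚ*x] n a ⟨
  invℕ (suc n) * (ℕ→ℚ (suc n) * a)    ≡⟨ cong (_*_ (invℕ (suc n))) eq ⟩
  invℕ (suc n) * (ℕ→ℚ (suc n) * b)    ≡⟨ invℕ*[ℕ→ℚ*x] n b ⟩
  b                                   ∎

-- Finite sums

sumFrom-cong : ∀ lo l {f g : ℕ → ℚ} → (∀ i → i < lo ℕ.+ l → f i ≡ g i) →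
               sumFrom lo l f ≡ sumFrom lo l g
sumFrom-cong lo zero    eq = refl
sumFrom-cong lo (suc l) eq = cong₂ _+_ (eq lo (ℕ.m<m+n lo ℕ.z<s))
  (sumFrom-cong (suc lo) l (λ i i< → eq i (subst (i <_) (sym (ℕ.+-suc lo l)) i<)))

sumFrom-ext : ∀ lo l {f g : ℕ → ℚ} → (∀ i → f i ≡ g i) → sumFrom lo l f ≡ sumFrom lo l g
sumFrom-ext lo l eq = sumFrom-cong lo l (λ i _ → eq i)

sumUpTo-cong : ∀ m {f g : ℕ → ℚ} → (∀ i → i ≤ m → f i ≡ g i) →
               sumFrom 0 (suc m) f ≡ sumFrom 0 (suc m) g
sumUpTo-cong m eq = sumFrom-cong 0 (suc m) (λ i i<1+m → eq i (ℕ.≤-pred i<1+m))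

sumFrom-zero : ∀ lo l {f : ℕ → ℚ} → (∀ i → f i ≡ 0ℚ) → sumFrom lo l f ≡ 0ℚ
sumFrom-zero lo zero    eq = refl
sumFrom-zero lo (suc l) eq = trans (cong₂ _+_ (eq lo) (sumFrom-zero (suc lo) l eq)) (ℚ.+-identityʳ 0ℚ)

sumFrom-snoc : ∀ lo l (f : ℕ → ℚ) → sumFrom lo (suc l) f ≡ sumFrom lo l f + f (lo ℕ.+ l)
sumFrom-snoc lo zero    f = begin
  f lo + 0ℚ        ≡⟨ ℚ.+-comm (f lo) 0ℚ ⟩
  0ℚ + f lo        ≡⟨ cong (λ k → 0ℚ + f k) (ℕ.+-identityʳ lo) ⟨
  0ℚ + f (lo ℕ.+ 0) ∎
sumFrom-snoc lo (suc l) f = begin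
  f lo + sumFrom (suc lo) (suc l) f            ≡⟨ cong (_+_ (f lo)) (sumFrom-snoc (suc lo) l f) ⟩
  f lo + (sumFrom (suc lo) l f + f (suc lo ℕ.+ l)) ≡⟨ ℚ.+-assoc (f lo) _ _ ⟨
  sumFrom lo (suc l) f + f (suc lo ℕ.+ l)        ≡⟨ cong (λ k → sumFrom lo (suc l) f + f k) (ℕ.+-suc lo l) ⟨
  sumFrom lo (suc l) f + f (lo ℕ.+ suc l)        ∎

sumFrom-shift : ∀ lo l (f : ℕ → ℚ) → sumFrom (suc lo) l f ≡ sumFrom lo l (λ i → f (suc i))
sumFrom-shift lo zero    f = refl
sumFrom-shift lo (suc l) f = cong (_+_ (f (suc lo))) (sumFrom-shift (suc lo) l f)

sumFrom-+ : ∀ lo l (f g : ℕ → ℚ) → sumFrom lo l (λ i → f i + g i) ≡ sumFrom lo l f + sumFrom lo l g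
sumFrom-+ lo zero    f g = refl
sumFrom-+ lo (suc l) f g =
  trans (cong (λ s → f lo + g lo + s) (sumFrom-+ (suc lo) l f g)) (interchange (f lo) (g lo) _ _)
  where
  interchange : ∀ a b c d → (a + b) + (c + d) ≡ (a + c) + (b + d)
  interchange = solve-∀ ℚ-ring

sumFrom-*ˡ : ∀ lo l (a : ℚ) (f : ℕ → ℚ) → sumFrom lo l (λ i → a * f i) ≡ a * sumFrom lo l f
sumFrom-*ˡ lo zero    a f = sym (ℚ.*-zeroʳ a)
sumFrom-*ˡ lo (suc l) a f =
  trans (cong (λ s → a * f lo + s) (sumFrom-*ˡ (suc lo) l a f)) (sym (ℚ.*-distribˡ-+ a (f lo) _))

suc-∸ : ∀ {m n} → n ≤ m → suc m ∸ n ≡ suc (m ∸ n)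
suc-∸ = ℕ.+-∸-assoc 1

sumFrom-triangle : ∀ N (f : ℕ → ℕ → ℚ) →
  sumFrom 0 (suc N) (λ j → sumFrom 0 (suc (N ∸ j)) (f j)) ≡
  sumFrom 0 (suc N) (λ k → sumFrom 0 (suc k) (λ j → f j (k ∸ j)))
sumFrom-triangle zero    f = refl
sumFrom-triangle (suc N) f = begin
  sumFrom 0 (suc (suc N)) (λ j → sumFrom 0 (suc (suc N ∸ j)) (f j))
    ≡⟨ sumFrom-snoc 0 (suc N) (λ j → sumFrom 0 (suc (suc N ∸ j)) (f j)) ⟩
  sumFrom 0 (suc N) (λ j → sumFrom 0 (suc (suc N ∸ j)) (f j)) + sumFrom 0 (suc (N ∸ N)) (f (suc N))
    ≡⟨ cong₂ _+_ rows last-row ⟩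
  (sumFrom 0 (suc N) (λ j → sumFrom 0 (suc (N ∸ j)) (f j)) + antidiagonal) + f (suc N) 0
    ≡⟨ cong (λ s → s + antidiagonal + f (suc N) 0) (sumFrom-triangle N f) ⟩
  (diagonals + antidiagonal) + f (suc N) 0
    ≡⟨ ℚ.+-assoc diagonals antidiagonal _ ⟩
  diagonals + (antidiagonal + f (suc N) 0)
    ≡⟨ cong (λ k → diagonals + (antidiagonal + f (suc N) k)) (ℕ.n∸n≡0 N) ⟨
  diagonals + (antidiagonal + corner (suc N))
    ≡⟨ cong (_+_ diagonals) (sumFrom-snoc 0 (suc N) corner) ⟨
  diagonals + sumFrom 0 (suc (suc N)) corner
    ≡⟨ sumFrom-snoc 0 (suc N) (λ k → sumFrom 0 (suc k) (λ j → f j (k ∸ j))) ⟨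
  sumFrom 0 (suc (suc N)) (λ k → sumFrom 0 (suc k) (λ j → f j (k ∸ j)))
    ∎
  where
  corner : ℕ → ℚ
  corner j = f j (suc N ∸ j)
  antidiagonal diagonals : ℚ
  antidiagonal = sumFrom 0 (suc N) corner
  diagonals = sumFrom 0 (suc N) (λ k → sumFrom 0 (suc k) (λ j → f j (k ∸ j)))
  row : ∀ j → j ≤ N →
        sumFrom 0 (suc (suc N ∸ j)) (f j) ≡ sumFrom 0 (suc (N ∸ j)) (f j) + corner j
  row j j≤N rewrite suc-∸ j≤N = sumFrom-snoc 0 (suc (N ∸ j)) (f j)
  rows : sumFrom 0 (suc N) (λ j → sumFrom 0 (suc (suc N ∸ j)) (f j)) ≡
         sumFrom 0 (suc N) (λ j → sumFrom 0 (suc (N ∸ j)) (f j)) + antidiagonal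
  rows = trans (sumUpTo-cong N row) (sumFrom-+ 0 (suc N) (λ j → sumFrom 0 (suc (N ∸ j)) (f j)) corner)
  last-row : sumFrom 0 (suc (N ∸ N)) (f (suc N)) ≡ f (suc N) 0
  last-row rewrite ℕ.n∸n≡0 N = ℚ.+-identityʳ (f (suc N) 0)

-- Binomial coefficients

nCk*[k!*[n∸k]!]≡n! : ∀ {n k} → k ≤ n → (n C k) ℕ.* (k ! ℕ.* (n ∸ k) !) ≡ n !
nCk*[k!*[n∸k]!]≡n! {n} {k} k≤n rewrite nCk≡n!/k![n-k]! k≤n =
  m/n*n≡m {{k ℕ.!* (n ∸ k) !≢0}} (k![n∸k]!∣n! k≤n)

[1+k]*[1+n]C[1+k]≡[1+n]*nCk : ∀ n k → suc k ℕ.* (suc n C suc k) ≡ suc n ℕ.* (n C k)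
[1+k]*[1+n]C[1+k]≡[1+n]*nCk n k with ℕ.≤-<-connex k n
... | inj₂ n<k rewrite k>n⇒nCk≡0 n<k | k>n⇒nCk≡0 (ℕ.s<s n<k) = trans (ℕ.*-zeroʳ (suc k)) (sym (ℕ.*-zeroʳ (suc n)))
... | inj₁ k≤n = ℕ.*-cancelʳ-≡ _ _ (k ! ℕ.* (n ∸ k) !) {{k ℕ.!* (n ∸ k) !≢0}} (begin
  suc k ℕ.* (suc n C suc k) ℕ.* (k ! ℕ.* (n ∸ k) !)
    ≡⟨ reassoc (suc k) (suc n C suc k) (k !) ((n ∸ k) !) ⟩
  (suc n C suc k) ℕ.* (suc k ! ℕ.* (n ∸ k) !)
    ≡⟨ nCk*[k!*[n∸k]!]≡n! (ℕ.s≤s k≤n) ⟩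
  suc n !
    ≡⟨ cong (suc n ℕ.*_) (nCk*[k!*[n∸k]!]≡n! k≤n) ⟨
  suc n ℕ.* ((n C k) ℕ.* (k ! ℕ.* (n ∸ k) !))
    ≡⟨ ℕ.*-assoc (suc n) (n C k) _ ⟨
  suc n ℕ.* (n C k) ℕ.* (k ! ℕ.* (n ∸ k) !)
    ∎)
  where
  reassoc : ∀ a c f g → a ℕ.* c ℕ.* (f ℕ.* g) ≡ c ℕ.* ((a ℕ.* f) ℕ.* g)
  reassoc = ℕ-Solver.solve-∀

m∸j∸[k∸j]≡m∸k : ∀ m {j k} → j ≤ k → (m ∸ j) ∸ (k ∸ j) ≡ m ∸ k
m∸j∸[k∸j]≡m∸k m {j} {k} j≤k = trans (ℕ.∸-+-assoc m j (k ∸ j)) (cong (m ∸_) (ℕ.m+[n∸m]≡n j≤k))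

mCj*[m∸j]C[k∸j]≡mCk*kCj : ∀ {m k j} → j ≤ k → k ≤ m →
  (m C j) ℕ.* ((m ∸ j) C (k ∸ j)) ≡ (m C k) ℕ.* (k C j)
mCj*[m∸j]C[k∸j]≡mCk*kCj {m} {k} {j} j≤k k≤m =
  ℕ.*-cancelʳ-≡ _ _ (j ! ℕ.* ((k ∸ j) ! ℕ.* (m ∸ k) !))
    {{ℕ.m*n≢0 (j !) _ {{j ℕ.!≢0}} {{(k ∸ j) ℕ.!* (m ∸ k) !≢0}}}} (begin
  (m C j) ℕ.* ((m ∸ j) C (k ∸ j)) ℕ.* (j ! ℕ.* ((k ∸ j) ! ℕ.* (m ∸ k) !))
    ≡⟨ reassocˡ (m C j) ((m ∸ j) C (k ∸ j)) (j !) ((k ∸ j) !) ((m ∸ k) !) ⟩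
  (m C j) ℕ.* (j ! ℕ.* (((m ∸ j) C (k ∸ j)) ℕ.* ((k ∸ j) ! ℕ.* (m ∸ k) !)))
    ≡⟨ cong (λ e → (m C j) ℕ.* (j ! ℕ.* (((m ∸ j) C (k ∸ j)) ℕ.* ((k ∸ j) ! ℕ.* e !)))) (m∸j∸[k∸j]≡m∸k m j≤k) ⟨
  (m C j) ℕ.* (j ! ℕ.* (((m ∸ j) C (k ∸ j)) ℕ.* ((k ∸ j) ! ℕ.* ((m ∸ j) ∸ (k ∸ j)) !)))
    ≡⟨ cong (λ e → (m C j) ℕ.* (j ! ℕ.* e)) (nCk*[k!*[n∸k]!]≡n! (ℕ.∸-monoˡ-≤ j k≤m)) ⟩
  (m C j) ℕ.* (j ! ℕ.* (m ∸ j) !)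
    ≡⟨ nCk*[k!*[n∸k]!]≡n! (ℕ.≤-trans j≤k k≤m) ⟩
  m !
    ≡⟨ nCk*[k!*[n∸k]!]≡n! k≤m ⟨
  (m C k) ℕ.* (k ! ℕ.* (m ∸ k) !)
    ≡⟨ cong (λ e → (m C k) ℕ.* (e ℕ.* (m ∸ k) !)) (nCk*[k!*[n∸k]!]≡n! j≤k) ⟨
  (m C k) ℕ.* ((k C j) ℕ.* (j ! ℕ.* (k ∸ j) !) ℕ.* (m ∸ k) !)
    ≡⟨ reassocʳ (m C k) (k C j) (j !) ((k ∸ j) !) ((m ∸ k) !) ⟩
  (m C k) ℕ.* (k C j) ℕ.* (j ! ℕ.* ((k ∸ j) ! ℕ.* (m ∸ k) !))
    ∎)
  where
  reassocˡ : ∀ a b f g h → a ℕ.* b ℕ.* (f ℕ.* (g ℕ.* h)) ≡ a ℕ.* (f ℕ.* (b ℕ.* (g ℕ.* h)))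
  reassocˡ = ℕ-Solver.solve-∀
  reassocʳ : ∀ a b f g h → a ℕ.* (b ℕ.* (f ℕ.* g) ℕ.* h) ≡ a ℕ.* b ℕ.* (f ℕ.* (g ℕ.* h))
  reassocʳ = ℕ-Solver.solve-∀

[1+n]Cn≡1+n : ∀ n → (suc n C n) ≡ suc n
[1+n]Cn≡1+n n = trans (nCk≡nC[n∸k] (ℕ.n≤1+n n)) (trans (cong (suc n C_) (ℕ.m+n∸n≡m 1 n)) (nC1≡n (suc n)))

sumUpTo-C-extend : ∀ r (g : ℕ → ℚ) →
  sumFrom 0 (suc (suc r)) (λ i → ℕ→ℚ (r C i) * g i) ≡ sumFrom 0 (suc r) (λ i → ℕ→ℚ (r C i) * g i)
sumUpTo-C-extend r g = begin
  sumFrom 0 (suc (suc r)) (λ i → ℕ→ℚ (r C i) * g i)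
    ≡⟨ sumFrom-snoc 0 (suc r) (λ i → ℕ→ℚ (r C i) * g i) ⟩
  sumFrom 0 (suc r) (λ i → ℕ→ℚ (r C i) * g i) + ℕ→ℚ (r C suc r) * g (suc r)
    ≡⟨ cong (λ c → sumFrom 0 (suc r) (λ i → ℕ→ℚ (r C i) * g i) + ℕ→ℚ c * g (suc r)) (k>n⇒nCk≡0 (ℕ.n<1+n r)) ⟩
  sumFrom 0 (suc r) (λ i → ℕ→ℚ (r C i) * g i) + 0ℚ * g (suc r)
    ≡⟨ cong (_+_ (sumFrom 0 (suc r) (λ i → ℕ→ℚ (r C i) * g i))) (ℚ.*-zeroˡ (g (suc r))) ⟩
  sumFrom 0 (suc r) (λ i → ℕ→ℚ (r C i) * g i) + 0ℚ
    ≡⟨ ℚ.+-identityʳ _ ⟩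
  sumFrom 0 (suc r) (λ i → ℕ→ℚ (r C i) * g i) ∎

sumUpTo-Pascal : ∀ r (g : ℕ → ℚ) →
  sumFrom 0 (suc (suc r)) (λ i → ℕ→ℚ (suc r C i) * g i) ≡
  sumFrom 0 (suc r) (λ i → ℕ→ℚ (r C i) * (g i + g (suc i)))
sumUpTo-Pascal r g = begin
  ℕ→ℚ 1 * g 0 + sumFrom 1 (suc r) (λ i → ℕ→ℚ (suc r C i) * g i)
    ≡⟨ cong (_+_ (ℕ→ℚ 1 * g 0)) (trans (sumFrom-shift 0 (suc r) (λ i → ℕ→ℚ (suc r C i) * g i)) (sumFrom-ext 0 (suc r) pascal)) ⟩
  ℕ→ℚ 1 * g 0 + sumFrom 0 (suc r) (λ i → shifted i + raised i)
    ≡⟨ cong (_+_ (ℕ→ℚ 1 * g 0)) (sumFrom-+ 0 (suc r) shifted raised) ⟩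
  ℕ→ℚ 1 * g 0 + (sumFrom 0 (suc r) shifted + sumFrom 0 (suc r) raised)
    ≡⟨ rearrange (ℕ→ℚ 1 * g 0) (sumFrom 0 (suc r) shifted) _ ⟩
  (ℕ→ℚ 1 * g 0 + sumFrom 0 (suc r) raised) + sumFrom 0 (suc r) shifted
    ≡⟨ cong (λ s → ℕ→ℚ 1 * g 0 + s + sumFrom 0 (suc r) shifted) (sumFrom-shift 0 (suc r) unshifted) ⟨
  sumFrom 0 (suc (suc r)) unshifted + sumFrom 0 (suc r) shifted
    ≡⟨ cong (_+ sumFrom 0 (suc r) shifted) (sumUpTo-C-extend r g) ⟩
  sumFrom 0 (suc r) unshifted + sumFrom 0 (suc r) shifted
    ≡⟨ sumFrom-+ 0 (suc r) unshifted shifted ⟨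
  sumFrom 0 (suc r) (λ i → unshifted i + shifted i)
    ≡⟨ sumFrom-ext 0 (suc r) (λ i → ℚ.*-distribˡ-+ (ℕ→ℚ (r C i)) (g i) (g (suc i))) ⟨
  sumFrom 0 (suc r) (λ i → ℕ→ℚ (r C i) * (g i + g (suc i))) ∎
  where
  unshifted shifted raised : ℕ → ℚ
  unshifted i = ℕ→ℚ (r C i) * g i
  shifted i = ℕ→ℚ (r C i) * g (suc i)
  raised i = ℕ→ℚ (r C suc i) * g (suc i)
  pascal : ∀ i → ℕ→ℚ (suc r C suc i) * g (suc i) ≡ shifted i + raised i
  pascal i = begin
    ℕ→ℚ (suc r C suc i) * g (suc i)
      ≡⟨ cong (λ c → ℕ→ℚ c * g (suc i)) (nCk+nC[k+1]≡[n+1]C[k+1] r i) ⟨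
    ℕ→ℚ ((r C i) ℕ.+ (r C suc i)) * g (suc i)
      ≡⟨ cong (_* g (suc i)) (ℕ→ℚ-+ (r C i) (r C suc i)) ⟩
    (ℕ→ℚ (r C i) + ℕ→ℚ (r C suc i)) * g (suc i)
      ≡⟨ ℚ.*-distribʳ-+ (g (suc i)) (ℕ→ℚ (r C i)) (ℕ→ℚ (r C suc i)) ⟩
    shifted i + raised i ∎
  rearrange : ∀ a b c → a + (b + c) ≡ (a + c) + b
  rearrange = solve-∀ ℚ-ring

binomial-theorem : ∀ r x → (x + 1ℚ) ^ℚ r ≡ sumFrom 0 (suc r) (λ i → ℕ→ℚ (r C i) * x ^ℚ (r ∸ i))
binomial-theorem zero    x = refl
binomial-theorem (suc r) x = begin
  (x + 1ℚ) * (x + 1ℚ) ^ℚ r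
    ≡⟨ cong (_*_ (x + 1ℚ)) (binomial-theorem r x) ⟩
  (x + 1ℚ) * sumFrom 0 (suc r) (λ i → ℕ→ℚ (r C i) * x ^ℚ (r ∸ i))
    ≡⟨ sumFrom-*ˡ 0 (suc r) (x + 1ℚ) _ ⟨
  sumFrom 0 (suc r) (λ i → (x + 1ℚ) * (ℕ→ℚ (r C i) * x ^ℚ (r ∸ i)))
    ≡⟨ sumUpTo-cong r term ⟩
  sumFrom 0 (suc r) (λ i → ℕ→ℚ (r C i) * (x ^ℚ (suc r ∸ i) + x ^ℚ (r ∸ i)))
    ≡⟨ sumUpTo-Pascal r (λ i → x ^ℚ (suc r ∸ i)) ⟨
  sumFrom 0 (suc (suc r)) (λ i → ℕ→ℚ (suc r C i) * x ^ℚ (suc r ∸ i)) ∎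
  where
  distrib : ∀ x c y → (x + 1ℚ) * (c * y) ≡ c * (x * y + y)
  distrib = solve-∀ ℚ-ring
  term : ∀ i → i ≤ r → (x + 1ℚ) * (ℕ→ℚ (r C i) * x ^ℚ (r ∸ i)) ≡ ℕ→ℚ (r C i) * (x ^ℚ (suc r ∸ i) + x ^ℚ (r ∸ i))
  term i i≤r rewrite suc-∸ i≤r = distrib x (ℕ→ℚ (r C i)) (x ^ℚ (r ∸ i))

-- Bernoulli numbers

module _ {a b c} {A : Set a} {B : Set b} {C : Set c} (f : A → B → C) where

  zipWith-∷ʳ : ∀ {xs : List A} {ys : List B} → length xs ≡ length ys → ∀ x y →
               zipWith f (xs ∷ʳ x) (ys ∷ʳ y) ≡ zipWith f xs ys ∷ʳ f x y
  zipWith-∷ʳ {[]}     {[]}     _   x y = refl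
  zipWith-∷ʳ {x′ ∷ xs} {y′ ∷ ys} eq x y = cong (f x′ y′ ∷_) (zipWith-∷ʳ (ℕ.suc-injective eq) x y)

bernoulliList-length : ∀ m → length (bernoulliList m) ≡ m
bernoulliList-length zero    = refl
bernoulliList-length (suc m) =
  trans (List.length-++ (bernoulliList m)) (trans (ℕ.+-comm _ 1) (cong suc (bernoulliList-length m)))

-- The list folded over in the definition of `Bernoulli` (as the private `indexed`).
indexedBernoulli : ℕ → List (ℕ × ℚ)
indexedBernoulli m = zipWith _,_ (upTo (length (bernoulliList m))) (bernoulliList m)

indexedBernoulli-suc : ∀ m → indexedBernoulli (suc m) ≡ indexedBernoulli m ∷ʳ (m , Bernoulli m)
indexedBernoulli-suc m = begin
  zipWith _,_ (upTo (length (bernoulliList (suc m)))) (bernoulliList (suc m))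
    ≡⟨ cong (λ l → zipWith _,_ (upTo l) (bernoulliList (suc m))) (bernoulliList-length (suc m)) ⟩
  zipWith _,_ (upTo (suc m)) (bernoulliList (suc m))
    ≡⟨ cong (λ u → zipWith _,_ u (bernoulliList (suc m))) (List.upTo-∷ʳ m) ⟨
  zipWith _,_ (upTo m ∷ʳ m) (bernoulliList m ∷ʳ Bernoulli m)
    ≡⟨ zipWith-∷ʳ _,_ (trans (List.length-upTo m) (sym (bernoulliList-length m))) m (Bernoulli m) ⟩
  zipWith _,_ (upTo m) (bernoulliList m) ∷ʳ (m , Bernoulli m)
    ≡⟨ cong (λ l → zipWith _,_ (upTo l) (bernoulliList m) ∷ʳ (m , Bernoulli m)) (bernoulliList-length m) ⟨
  indexedBernoulli m ∷ʳ (m , Bernoulli m)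
    ∎

foldr-indexedBernoulli : ∀ (w : ℕ → ℚ) (g : ℕ × ℚ → ℚ → ℚ) → (∀ j b acc → g (j , b) acc ≡ w j * b + acc) →
  ∀ m acc → foldr g acc (indexedBernoulli m) ≡ sumFrom 0 m (λ j → w j * Bernoulli j) + acc
foldr-indexedBernoulli w g g-spec zero    acc = sym (ℚ.+-identityˡ acc)
foldr-indexedBernoulli w g g-spec (suc m) acc = begin
  foldr g acc (indexedBernoulli (suc m))
    ≡⟨ cong (foldr g acc) (indexedBernoulli-suc m) ⟩
  foldr g acc (indexedBernoulli m ∷ʳ (m , Bernoulli m))
    ≡⟨ List.foldr-++ g acc (indexedBernoulli m) _ ⟩
  foldr g (g (m , Bernoulli m) acc) (indexedBernoulli m)
    ≡⟨ foldr-indexedBernoulli w g g-spec m _ ⟩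
  sumFrom 0 m wB + g (m , Bernoulli m) acc
    ≡⟨ cong (_+_ (sumFrom 0 m wB)) (g-spec m (Bernoulli m) acc) ⟩
  sumFrom 0 m wB + (wB m + acc)
    ≡⟨ ℚ.+-assoc (sumFrom 0 m wB) (wB m) acc ⟨
  (sumFrom 0 m wB + wB m) + acc
    ≡⟨ cong (_+ acc) (sumFrom-snoc 0 m wB) ⟨
  sumFrom 0 (suc m) wB + acc
    ∎
  where
  wB : ℕ → ℚ
  wB j = w j * Bernoulli j

Bernoulli-unfold : ∀ r →
  Bernoulli r ≡ (ℕ→ℚ (suc r) - sumFrom 0 r (λ j → ℕ→ℚ (suc r C j) * Bernoulli j)) * invℕ (suc r)
Bernoulli-unfold r = cong (λ s → (ℕ→ℚ (suc r) - s) * invℕ (suc r))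
  (trans (foldr-indexedBernoulli (λ j → ℕ→ℚ (suc r C j)) _ (λ _ _ _ → refl) r 0ℚ) (ℚ.+-identityʳ _))

Bernoulli-defining : ∀ r → sumFrom 0 (suc r) (λ j → ℕ→ℚ (suc r C j) * Bernoulli j) ≡ ℕ→ℚ (suc r)
Bernoulli-defining r = begin
  sumFrom 0 (suc r) (λ j → ℕ→ℚ (suc r C j) * Bernoulli j)
    ≡⟨ sumFrom-snoc 0 r (λ j → ℕ→ℚ (suc r C j) * Bernoulli j) ⟩
  S + ℕ→ℚ (suc r C r) * Bernoulli r
    ≡⟨ cong (λ c → S + ℕ→ℚ c * Bernoulli r) ([1+n]Cn≡1+n r) ⟩
  S + R * Bernoulli r
    ≡⟨ cong (λ b → S + R * b) (Bernoulli-unfold r) ⟩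
  S + R * ((R - S) * invℕ (suc r))
    ≡⟨ cong (_+_ S) (trans (reassoc R (R - S) (invℕ (suc r))) (invℕ*[ℕ→ℚ*x] r (R - S))) ⟩
  S + (R - S)
    ≡⟨ cancel S R ⟩
  R ∎
  where
  R = ℕ→ℚ (suc r)
  S = sumFrom 0 r (λ j → ℕ→ℚ (suc r C j) * Bernoulli j)
  reassoc : ∀ R T i → R * (T * i) ≡ i * (R * T)
  reassoc = solve-∀ ℚ-ring
  cancel : ∀ S R → S + (R - S) ≡ R
  cancel = solve-∀ ℚ-ring

Bernoulli-recurrence : ∀ k → sumFrom 0 (suc k) (λ j → ℕ→ℚ (k C j) * Bernoulli j) ≡ Bernoulli k + ℕ→ℚ k
Bernoulli-recurrence zero    = cong (_+ 0ℚ) (ℚ.*-identityˡ (Bernoulli 0))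
Bernoulli-recurrence (suc r) = begin
  sumFrom 0 (suc (suc r)) (λ j → ℕ→ℚ (suc r C j) * Bernoulli j)
    ≡⟨ sumFrom-snoc 0 (suc r) (λ j → ℕ→ℚ (suc r C j) * Bernoulli j) ⟩
  sumFrom 0 (suc r) (λ j → ℕ→ℚ (suc r C j) * Bernoulli j) + ℕ→ℚ (suc r C suc r) * Bernoulli (suc r)
    ≡⟨ cong₂ (λ s c → s + ℕ→ℚ c * Bernoulli (suc r)) (Bernoulli-defining r) (nCn≡1 (suc r)) ⟩
  ℕ→ℚ (suc r) + 1ℚ * Bernoulli (suc r)
    ≡⟨ cong (_+_ (ℕ→ℚ (suc r))) (ℚ.*-identityˡ (Bernoulli (suc r))) ⟩
  ℕ→ℚ (suc r) + Bernoulli (suc r)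
    ≡⟨ ℚ.+-comm (ℕ→ℚ (suc r)) (Bernoulli (suc r)) ⟩
  Bernoulli (suc r) + ℕ→ℚ (suc r) ∎

-- Bernoulli polynomials

bernoulliPolynomial : ℕ → ℚ → ℚ
bernoulliPolynomial m x = sumFrom 0 (suc m) (λ j → ℕ→ℚ (m C j) * Bernoulli j * x ^ℚ (m ∸ j))

bernoulliPolynomial-shift : ∀ m x → bernoulliPolynomial m (x + 1ℚ) ≡
  bernoulliPolynomial m x + sumFrom 0 (suc m) (λ k → ℕ→ℚ (m C k) * ℕ→ℚ k * x ^ℚ (m ∸ k))
bernoulliPolynomial-shift m x = begin
  sumFrom 0 (suc m) (λ j → c j * (x + 1ℚ) ^ℚ (m ∸ j))
    ≡⟨ sumFrom-ext 0 (suc m) expand ⟩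
  sumFrom 0 (suc m) (λ j → sumFrom 0 (suc (m ∸ j)) (term j))
    ≡⟨ sumFrom-triangle m term ⟩
  sumFrom 0 (suc m) (λ k → sumFrom 0 (suc k) (λ j → term j (k ∸ j)))
    ≡⟨ sumUpTo-cong m collect ⟩
  sumFrom 0 (suc m) (λ k → ℕ→ℚ (m C k) * Bernoulli k * x ^ℚ (m ∸ k) + ℕ→ℚ (m C k) * ℕ→ℚ k * x ^ℚ (m ∸ k))
    ≡⟨ sumFrom-+ 0 (suc m) (λ k → ℕ→ℚ (m C k) * Bernoulli k * x ^ℚ (m ∸ k)) (λ k → ℕ→ℚ (m C k) * ℕ→ℚ k * x ^ℚ (m ∸ k)) ⟩
  bernoulliPolynomial m x + sumFrom 0 (suc m) (λ k → ℕ→ℚ (m C k) * ℕ→ℚ k * x ^ℚ (m ∸ k)) ∎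
  where
  c : ℕ → ℚ
  c j = ℕ→ℚ (m C j) * Bernoulli j
  term : ℕ → ℕ → ℚ
  term j i = c j * (ℕ→ℚ ((m ∸ j) C i) * x ^ℚ ((m ∸ j) ∸ i))
  expand : ∀ j → c j * (x + 1ℚ) ^ℚ (m ∸ j) ≡ sumFrom 0 (suc (m ∸ j)) (term j)
  expand j = trans (cong (_*_ (c j)) (binomial-theorem (m ∸ j) x)) (sym (sumFrom-*ˡ 0 (suc (m ∸ j)) (c j) (λ i → ℕ→ℚ ((m ∸ j) C i) * x ^ℚ ((m ∸ j) ∸ i))))
  regroup : ∀ a b c y → a * b * (c * y) ≡ (a * c) * y * b
  regroup = solve-∀ ℚ-ring
  regroup′ : ∀ a c y b → (a * c) * y * b ≡ (a * y) * (c * b)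
  regroup′ = solve-∀ ℚ-ring
  reorder : ∀ j k → j ≤ k → k ≤ m →
            term j (k ∸ j) ≡ (ℕ→ℚ (m C k) * x ^ℚ (m ∸ k)) * (ℕ→ℚ (k C j) * Bernoulli j)
  reorder j k j≤k k≤m = begin
    ℕ→ℚ (m C j) * Bernoulli j * (ℕ→ℚ ((m ∸ j) C (k ∸ j)) * x ^ℚ ((m ∸ j) ∸ (k ∸ j)))
      ≡⟨ cong (λ e → c j * (ℕ→ℚ ((m ∸ j) C (k ∸ j)) * x ^ℚ e)) (m∸j∸[k∸j]≡m∸k m j≤k) ⟩
    ℕ→ℚ (m C j) * Bernoulli j * (ℕ→ℚ ((m ∸ j) C (k ∸ j)) * x ^ℚ (m ∸ k))
      ≡⟨ regroup (ℕ→ℚ (m C j)) (Bernoulli j) _ _ ⟩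
    ℕ→ℚ (m C j) * ℕ→ℚ ((m ∸ j) C (k ∸ j)) * x ^ℚ (m ∸ k) * Bernoulli j
      ≡⟨ cong (λ a → a * x ^ℚ (m ∸ k) * Bernoulli j) (ℕ→ℚ-* (m C j) ((m ∸ j) C (k ∸ j))) ⟨
    ℕ→ℚ ((m C j) ℕ.* ((m ∸ j) C (k ∸ j))) * x ^ℚ (m ∸ k) * Bernoulli j
      ≡⟨ cong (λ a → ℕ→ℚ a * x ^ℚ (m ∸ k) * Bernoulli j) (mCj*[m∸j]C[k∸j]≡mCk*kCj j≤k k≤m) ⟩
    ℕ→ℚ ((m C k) ℕ.* (k C j)) * x ^ℚ (m ∸ k) * Bernoulli j
      ≡⟨ cong (λ a → a * x ^ℚ (m ∸ k) * Bernoulli j) (ℕ→ℚ-* (m C k) (k C j)) ⟩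
    ℕ→ℚ (m C k) * ℕ→ℚ (k C j) * x ^ℚ (m ∸ k) * Bernoulli j
      ≡⟨ regroup′ (ℕ→ℚ (m C k)) _ _ _ ⟩
    (ℕ→ℚ (m C k) * x ^ℚ (m ∸ k)) * (ℕ→ℚ (k C j) * Bernoulli j) ∎
  distrib : ∀ a y b k → (a * y) * (b + k) ≡ a * b * y + a * k * y
  distrib = solve-∀ ℚ-ring
  collect : ∀ k → k ≤ m → sumFrom 0 (suc k) (λ j → term j (k ∸ j)) ≡
            ℕ→ℚ (m C k) * Bernoulli k * x ^ℚ (m ∸ k) + ℕ→ℚ (m C k) * ℕ→ℚ k * x ^ℚ (m ∸ k)
  collect k k≤m = begin
    sumFrom 0 (suc k) (λ j → term j (k ∸ j))
      ≡⟨ sumUpTo-cong k (λ j j≤k → reorder j k j≤k k≤m) ⟩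
    sumFrom 0 (suc k) (λ j → (ℕ→ℚ (m C k) * x ^ℚ (m ∸ k)) * (ℕ→ℚ (k C j) * Bernoulli j))
      ≡⟨ sumFrom-*ˡ 0 (suc k) (ℕ→ℚ (m C k) * x ^ℚ (m ∸ k)) (λ j → ℕ→ℚ (k C j) * Bernoulli j) ⟩
    (ℕ→ℚ (m C k) * x ^ℚ (m ∸ k)) * sumFrom 0 (suc k) (λ j → ℕ→ℚ (k C j) * Bernoulli j)
      ≡⟨ cong (_*_ (ℕ→ℚ (m C k) * x ^ℚ (m ∸ k))) (Bernoulli-recurrence k) ⟩
    (ℕ→ℚ (m C k) * x ^ℚ (m ∸ k)) * (Bernoulli k + ℕ→ℚ k)
      ≡⟨ distrib (ℕ→ℚ (m C k)) _ _ _ ⟩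
    ℕ→ℚ (m C k) * Bernoulli k * x ^ℚ (m ∸ k) + ℕ→ℚ (m C k) * ℕ→ℚ k * x ^ℚ (m ∸ k) ∎

sumUpTo-C*k*pow : ∀ q x →
  sumFrom 0 (suc (suc q)) (λ k → ℕ→ℚ (suc q C k) * ℕ→ℚ k * x ^ℚ (suc q ∸ k)) ≡ ℕ→ℚ (suc q) * (x + 1ℚ) ^ℚ q
sumUpTo-C*k*pow q x = begin
  ℕ→ℚ 1 * 0ℚ * x ^ℚ suc q + sumFrom 1 (suc q) (λ k → ℕ→ℚ (suc q C k) * ℕ→ℚ k * x ^ℚ (suc q ∸ k))
    ≡⟨ cong₂ _+_ vanishing (sumFrom-shift 0 (suc q) (λ k → ℕ→ℚ (suc q C k) * ℕ→ℚ k * x ^ℚ (suc q ∸ k))) ⟩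
  0ℚ + sumFrom 0 (suc q) (λ k → ℕ→ℚ (suc q C suc k) * ℕ→ℚ (suc k) * x ^ℚ (q ∸ k))
    ≡⟨ ℚ.+-identityˡ _ ⟩
  sumFrom 0 (suc q) (λ k → ℕ→ℚ (suc q C suc k) * ℕ→ℚ (suc k) * x ^ℚ (q ∸ k))
    ≡⟨ sumFrom-ext 0 (suc q) absorb ⟩
  sumFrom 0 (suc q) (λ k → ℕ→ℚ (suc q) * (ℕ→ℚ (q C k) * x ^ℚ (q ∸ k)))
    ≡⟨ sumFrom-*ˡ 0 (suc q) (ℕ→ℚ (suc q)) _ ⟩
  ℕ→ℚ (suc q) * sumFrom 0 (suc q) (λ k → ℕ→ℚ (q C k) * x ^ℚ (q ∸ k))
    ≡⟨ cong (_*_ (ℕ→ℚ (suc q))) (binomial-theorem q x) ⟨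
  ℕ→ℚ (suc q) * (x + 1ℚ) ^ℚ q ∎
  where
  vanishing : ℕ→ℚ 1 * 0ℚ * x ^ℚ suc q ≡ 0ℚ
  vanishing = ℚ.*-zeroˡ (x ^ℚ suc q)
  swap : ∀ c k y → c * k * y ≡ (k * c) * y
  swap = solve-∀ ℚ-ring
  absorb : ∀ k → ℕ→ℚ (suc q C suc k) * ℕ→ℚ (suc k) * x ^ℚ (q ∸ k) ≡ ℕ→ℚ (suc q) * (ℕ→ℚ (q C k) * x ^ℚ (q ∸ k))
  absorb k = begin
    ℕ→ℚ (suc q C suc k) * ℕ→ℚ (suc k) * x ^ℚ (q ∸ k)
      ≡⟨ swap (ℕ→ℚ (suc q C suc k)) _ _ ⟩
    (ℕ→ℚ (suc k) * ℕ→ℚ (suc q C suc k)) * x ^ℚ (q ∸ k)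
      ≡⟨ cong (_* x ^ℚ (q ∸ k)) (ℕ→ℚ-* (suc k) (suc q C suc k)) ⟨
    ℕ→ℚ (suc k ℕ.* (suc q C suc k)) * x ^ℚ (q ∸ k)
      ≡⟨ cong (λ a → ℕ→ℚ a * x ^ℚ (q ∸ k)) ([1+k]*[1+n]C[1+k]≡[1+n]*nCk q k) ⟩
    ℕ→ℚ (suc q ℕ.* (q C k)) * x ^ℚ (q ∸ k)
      ≡⟨ cong (_* x ^ℚ (q ∸ k)) (ℕ→ℚ-* (suc q) (q C k)) ⟩
    (ℕ→ℚ (suc q) * ℕ→ℚ (q C k)) * x ^ℚ (q ∸ k)
      ≡⟨ ℚ.*-assoc (ℕ→ℚ (suc q)) _ _ ⟩
    ℕ→ℚ (suc q) * (ℕ→ℚ (q C k) * x ^ℚ (q ∸ k)) ∎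

-- The Bernoulli transform and Faulhaber's formula

bernoulliWeight : ℕ → ℕ → ℚ
bernoulliWeight q j = ℕ→ℚ (suc q C j) * Bernoulli j * invℕ (suc q)

bernoulliTransform : (ℕ → ℚ → ℚ) → ℕ → ℚ → ℚ
bernoulliTransform f q x = sumFrom 0 (suc q) (λ j → bernoulliWeight q j * f (q ∸ j) x)

faulhaber : ℕ → ℚ → ℚ
faulhaber = bernoulliTransform (λ r x → x ^ℚ suc r)

bernoulliTransform-zero : ∀ {f : ℕ → ℚ → ℚ} {x} → (∀ r → f r x ≡ 0ℚ) → ∀ q → bernoulliTransform f q x ≡ 0ℚ
bernoulliTransform-zero f≡0 q = sumFrom-zero 0 (suc q)
  (λ j → trans (cong (_*_ (bernoulliWeight q j)) (f≡0 (q ∸ j))) (ℚ.*-zeroʳ (bernoulliWeight q j)))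

bernoulliTransform-step : ∀ {f g : ℕ → ℚ → ℚ} {x y} c → (∀ r → f r y ≡ f r x + c * g r y) →
  ∀ q → bernoulliTransform f q y ≡ bernoulliTransform f q x + c * bernoulliTransform g q y
bernoulliTransform-step {f} {g} {x} {y} c step q = begin
  sumFrom 0 (suc q) (λ j → w j * f (q ∸ j) y)
    ≡⟨ sumFrom-ext 0 (suc q) (λ j → trans (cong (_*_ (w j)) (step (q ∸ j))) (distrib (w j) _ c _)) ⟩
  sumFrom 0 (suc q) (λ j → w j * f (q ∸ j) x + c * (w j * g (q ∸ j) y))
    ≡⟨ sumFrom-+ 0 (suc q) (λ j → w j * f (q ∸ j) x) (λ j → c * (w j * g (q ∸ j) y)) ⟩
  bernoulliTransform f q x + sumFrom 0 (suc q) (λ j → c * (w j * g (q ∸ j) y))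
    ≡⟨ cong (_+_ (bernoulliTransform f q x)) (sumFrom-*ˡ 0 (suc q) c (λ j → w j * g (q ∸ j) y)) ⟩
  bernoulliTransform f q x + c * bernoulliTransform g q y ∎
  where
  w = bernoulliWeight q
  distrib : ∀ w a c b → w * (a + c * b) ≡ w * a + c * (w * b)
  distrib = solve-∀ ℚ-ring

bernoulliPolynomial-faulhaber : ∀ q x →
  bernoulliPolynomial (suc q) x ≡ ℕ→ℚ (suc q) * faulhaber q x + Bernoulli (suc q)
bernoulliPolynomial-faulhaber q x = begin
  bernoulliPolynomial (suc q) x
    ≡⟨ sumFrom-snoc 0 (suc q) (λ j → ℕ→ℚ (suc q C j) * Bernoulli j * x ^ℚ (suc q ∸ j)) ⟩
  sumFrom 0 (suc q) (λ j → ℕ→ℚ (suc q C j) * Bernoulli j * x ^ℚ (suc q ∸ j))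
    + ℕ→ℚ (suc q C suc q) * Bernoulli (suc q) * x ^ℚ (q ∸ q)
    ≡⟨ cong₂ _+_ (sumUpTo-cong q scale) top ⟩
  sumFrom 0 (suc q) (λ j → R * (bernoulliWeight q j * x ^ℚ suc (q ∸ j))) + Bernoulli (suc q)
    ≡⟨ cong (_+ Bernoulli (suc q)) (sumFrom-*ˡ 0 (suc q) R (λ j → bernoulliWeight q j * x ^ℚ suc (q ∸ j))) ⟩
  R * faulhaber q x + Bernoulli (suc q) ∎
  where
  R = ℕ→ℚ (suc q)
  reassoc : ∀ R c b i y → R * (c * b * i * y) ≡ i * (R * (c * b * y))
  reassoc = solve-∀ ℚ-ring
  scale : ∀ j → j ≤ q →
    ℕ→ℚ (suc q C j) * Bernoulli j * x ^ℚ (suc q ∸ j) ≡ R * (bernoulliWeight q j * x ^ℚ suc (q ∸ j))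
  scale j j≤q = begin
    ℕ→ℚ (suc q C j) * Bernoulli j * x ^ℚ (suc q ∸ j)
      ≡⟨ cong (λ e → ℕ→ℚ (suc q C j) * Bernoulli j * x ^ℚ e) (suc-∸ j≤q) ⟩
    ℕ→ℚ (suc q C j) * Bernoulli j * x ^ℚ suc (q ∸ j)
      ≡⟨ invℕ*[ℕ→ℚ*x] q _ ⟨
    invℕ (suc q) * (R * (ℕ→ℚ (suc q C j) * Bernoulli j * x ^ℚ suc (q ∸ j)))
      ≡⟨ reassoc R (ℕ→ℚ (suc q C j)) (Bernoulli j) (invℕ (suc q)) (x ^ℚ suc (q ∸ j)) ⟨
    R * (bernoulliWeight q j * x ^ℚ suc (q ∸ j)) ∎
  top : ℕ→ℚ (suc q C suc q) * Bernoulli (suc q) * x ^ℚ (q ∸ q) ≡ Bernoulli (suc q)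
  top rewrite nCn≡1 (suc q) | ℕ.n∸n≡0 q = trans (ℚ.*-identityʳ _) (ℚ.*-identityˡ _)

faulhaber-shift : ∀ q x → faulhaber q (x + 1ℚ) ≡ faulhaber q x + (x + 1ℚ) ^ℚ q
faulhaber-shift q x = ℕ→ℚ[1+n]*-cancelˡ q (begin
  R * faulhaber q (x + 1ℚ)
    ≡⟨ add-sub (R * faulhaber q (x + 1ℚ)) B ⟩
  (R * faulhaber q (x + 1ℚ) + B) - B
    ≡⟨ cong (_- B) (bernoulliPolynomial-faulhaber q (x + 1ℚ)) ⟨
  bernoulliPolynomial (suc q) (x + 1ℚ) - B
    ≡⟨ cong (_- B) (bernoulliPolynomial-shift (suc q) x) ⟩
  (bernoulliPolynomial (suc q) x + sumFrom 0 (suc (suc q)) (λ k → ℕ→ℚ (suc q C k) * ℕ→ℚ k * x ^ℚ (suc q ∸ k))) - B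
    ≡⟨ cong₂ (λ a b → (a + b) - B) (bernoulliPolynomial-faulhaber q x) (sumUpTo-C*k*pow q x) ⟩
  ((R * faulhaber q x + B) + R * (x + 1ℚ) ^ℚ q) - B
    ≡⟨ collect R (faulhaber q x) B ((x + 1ℚ) ^ℚ q) ⟩
  R * (faulhaber q x + (x + 1ℚ) ^ℚ q) ∎)
  where
  R = ℕ→ℚ (suc q)
  B = Bernoulli (suc q)
  add-sub : ∀ a b → a ≡ (a + b) - b
  add-sub = solve-∀ ℚ-ring
  collect : ∀ R f b c → ((R * f + b) + R * c) - b ≡ R * (f + c)
  collect = solve-∀ ℚ-ring

faulhaber-zero : ∀ q → faulhaber q 0ℚ ≡ 0ℚ
faulhaber-zero = bernoulliTransform-zero {λ r x → x ^ℚ suc r} {0ℚ} (λ r → ℚ.*-zeroˡ (0ℚ ^ℚ r))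

-- C^{(p)}_0 and C^{(p)}_{0,0}

-- The innermost level of `Cp`, entered with s = j₁ + ⋯ + j_{r-1} ≤ p.
faulhaber-∸ : ∀ {p s} x → s ≤ p →
  sumFrom 0 (suc (p ∸ s)) (λ i → ℕ→ℚ ((suc p ∸ s) C i) * Bernoulli i * invℕ (suc p ∸ s) * x ^ℚ (suc p ∸ s ∸ i))
  ≡ faulhaber (p ∸ s) x
faulhaber-∸ {p} {s} x s≤p rewrite suc-∸ s≤p =
  sumUpTo-cong (p ∸ s) (λ i i≤ → cong (λ e → bernoulliWeight (p ∸ s) i * x ^ℚ e) (suc-∸ i≤))

C₀ C₀₀ : ℕ → ℚ → ℚ
C₀  = bernoulliTransform faulhaber
C₀₀ = bernoulliTransform C₀

Cp[0]≡C₀ : ∀ p x → Cp p (0 ∷ []) x ≡ C₀ p x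
Cp[0]≡C₀ p x = sumUpTo-cong p (λ j j≤p → cong (_*_ (bernoulliWeight p j)) (faulhaber-∸ x j≤p))

Cp[0,0]≡C₀₀ : ∀ p x → Cp p (0 ∷ 0 ∷ []) x ≡ C₀₀ p x
Cp[0,0]≡C₀₀ p x = sumUpTo-cong p (λ j j≤p → cong (_*_ (bernoulliWeight p j)) (middle j≤p))
  where
  innermost : ℕ → ℚ
  innermost s = sumFrom 0 (suc (p ∸ s))
    (λ i → ℕ→ℚ ((suc p ∸ s) C i) * Bernoulli i * invℕ (suc p ∸ s) * x ^ℚ (suc p ∸ s ∸ i))
  middle : ∀ {j} → j ≤ p →
    sumFrom 0 (suc (p ∸ j)) (λ k → ℕ→ℚ ((suc p ∸ j) C k) * Bernoulli k * invℕ (suc p ∸ j) * innermost (j ℕ.+ k))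
    ≡ C₀ (p ∸ j) x
  middle {j} j≤p rewrite suc-∸ j≤p = sumUpTo-cong (p ∸ j) (λ k k≤p∸j →
    cong (_*_ (bernoulliWeight (p ∸ j) k))
      (trans (faulhaber-∸ x (subst (j ℕ.+ k ≤_) (ℕ.m+[n∸m]≡n j≤p) (ℕ.+-monoʳ-≤ j k≤p∸j)))
             (cong (λ t → faulhaber t x) (sym (ℕ.∸-+-assoc p j k)))))

-- Harmonic sums

H-suc : ∀ n k ks → H (suc n) (k ∷ ks) ≡ H n (k ∷ ks) + powNeg (suc n) k * H n ks
H-suc n k ks = sumFrom-snoc 1 n (λ m → powNeg m k * H (m ∸ 1) ks)

module _ (n : ℕ) where

  private
    y = ℕ→ℚ (suc n)
    i = invℕ (suc n)

  H[-p]-suc : ∀ p → H (suc n) (- (+ p) ∷ []) ≡ H n (- (+ p) ∷ []) + y ^ℚ p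
  H[-p]-suc zero    = trans (H-suc n (- (+ 0)) []) (cong (_+_ (H n (- (+ 0) ∷ []))) (ℚ.*-identityʳ 1ℚ))
  H[-p]-suc (suc p) = trans (H-suc n (- (+ suc p)) []) (cong (_+_ (H n (- (+ suc p) ∷ []))) (ℚ.*-identityʳ (y ^ℚ suc p)))

  H[1]-suc : H (suc n) (+ 1 ∷ []) ≡ H n (+ 1 ∷ []) + i
  H[1]-suc = trans (H-suc n (+ 1) []) (cong (_+_ (H n (+ 1 ∷ []))) (trans (ℚ.*-identityʳ _) (ℚ.*-identityʳ i)))

  H[2]-suc : H (suc n) (+ 2 ∷ []) ≡ H n (+ 2 ∷ []) + i * i
  H[2]-suc = trans (H-suc n (+ 2) []) (cong (_+_ (H n (+ 2 ∷ []))) (trans (ℚ.*-identityʳ _) (cong (_*_ i) (ℚ.*-identityʳ i))))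

  H[1,1]-suc : H (suc n) (+ 1 ∷ + 1 ∷ []) ≡ H n (+ 1 ∷ + 1 ∷ []) + i * H n (+ 1 ∷ [])
  H[1,1]-suc = trans (H-suc n (+ 1) (+ 1 ∷ [])) (cong (λ c → H n (+ 1 ∷ + 1 ∷ []) + c * H n (+ 1 ∷ [])) (ℚ.*-identityʳ i))

  H[-p,1,1]-suc : ∀ p → H (suc n) (- (+ p) ∷ + 1 ∷ + 1 ∷ []) ≡
                H n (- (+ p) ∷ + 1 ∷ + 1 ∷ []) + y ^ℚ p * H n (+ 1 ∷ + 1 ∷ [])
  H[-p,1,1]-suc zero    = H-suc n (+ 0) (+ 1 ∷ + 1 ∷ [])
  H[-p,1,1]-suc (suc p) = H-suc n (- (+ suc p)) (+ 1 ∷ + 1 ∷ [])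

  faulhaber-step : ∀ r → faulhaber r y ≡ faulhaber r (ℕ→ℚ n) + i * y ^ℚ suc r
  faulhaber-step r = begin
    faulhaber r y                          ≡⟨ cong (faulhaber r) (ℕ→ℚ-suc n) ⟩
    faulhaber r (ℕ→ℚ n + 1ℚ)               ≡⟨ faulhaber-shift r (ℕ→ℚ n) ⟩
    faulhaber r (ℕ→ℚ n) + (ℕ→ℚ n + 1ℚ) ^ℚ r ≡⟨ cong (λ z → faulhaber r (ℕ→ℚ n) + z ^ℚ r) (ℕ→ℚ-suc n) ⟨
    faulhaber r (ℕ→ℚ n) + y ^ℚ r            ≡⟨ cong (_+_ (faulhaber r (ℕ→ℚ n))) (invℕ*[ℕ→ℚ*x] n (y ^ℚ r)) ⟨
    faulhaber r (ℕ→ℚ n) + i * y ^ℚ suc r    ∎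

  C₀-step : ∀ q → C₀ q y ≡ C₀ q (ℕ→ℚ n) + i * faulhaber q y
  C₀-step = bernoulliTransform-step {faulhaber} {λ r z → z ^ℚ suc r} {ℕ→ℚ n} {y} i faulhaber-step

  C₀₀-step : ∀ q → C₀₀ q y ≡ C₀₀ q (ℕ→ℚ n) + i * C₀ q y
  C₀₀-step = bernoulliTransform-step {C₀} {faulhaber} {ℕ→ℚ n} {y} i C₀-step

H[-p]≡faulhaber : ∀ p n → H n (- (+ p) ∷ []) ≡ faulhaber p (ℕ→ℚ n)
H[-p]≡faulhaber p zero    = sym (faulhaber-zero p)
H[-p]≡faulhaber p (suc n) = begin
  H (suc n) (- (+ p) ∷ [])                       ≡⟨ H[-p]-suc n p ⟩
  H n (- (+ p) ∷ []) + ℕ→ℚ (suc n) ^ℚ p           ≡⟨ cong (_+ ℕ→ℚ (suc n) ^ℚ p) (H[-p]≡faulhaber p n) ⟩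
  faulhaber p (ℕ→ℚ n) + ℕ→ℚ (suc n) ^ℚ p          ≡⟨ cong (_+_ (faulhaber p (ℕ→ℚ n))) (invℕ*[ℕ→ℚ*x] n _) ⟨
  faulhaber p (ℕ→ℚ n) + invℕ (suc n) * ℕ→ℚ (suc n) ^ℚ suc p ≡⟨ faulhaber-step n p ⟨
  faulhaber p (ℕ→ℚ (suc n))                       ∎

H[-p,1,1]-expansion : ∀ p n → H n (- (+ p) ∷ + 1 ∷ + 1 ∷ []) ≡
  H n (- (+ p) ∷ []) * H n (+ 1 ∷ + 1 ∷ []) - C₀ p (ℕ→ℚ n) * H n (+ 1 ∷ []) + C₀₀ p (ℕ→ℚ n)
H[-p,1,1]-expansion p zero = begin
  0ℚ                                   ≡⟨ empty (C₀ p 0ℚ) ⟩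
  0ℚ * 0ℚ - C₀ p 0ℚ * 0ℚ + 0ℚ           ≡⟨ cong (_+_ (0ℚ * 0ℚ - C₀ p 0ℚ * 0ℚ)) C₀₀-zero ⟨
  0ℚ * 0ℚ - C₀ p 0ℚ * 0ℚ + C₀₀ p 0ℚ     ∎
  where
  empty : ∀ c → 0ℚ ≡ 0ℚ * 0ℚ - c * 0ℚ + 0ℚ
  empty = solve-∀ ℚ-ring
  C₀₀-zero : C₀₀ p 0ℚ ≡ 0ℚ
  C₀₀-zero = bernoulliTransform-zero {C₀} {0ℚ} (bernoulliTransform-zero {faulhaber} {0ℚ} faulhaber-zero) p
H[-p,1,1]-expansion p (suc n) = begin
  H (suc n) (- (+ p) ∷ + 1 ∷ + 1 ∷ [])
    ≡⟨ H[-p,1,1]-suc n p ⟩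
  H n (- (+ p) ∷ + 1 ∷ + 1 ∷ []) + yᵖ * h₁₁
    ≡⟨ cong (_+ yᵖ * h₁₁) (H[-p,1,1]-expansion p n) ⟩
  (A * h₁₁ - G * h₁ + K) + yᵖ * h₁₁
    ≡⟨ telescope A h₁₁ h₁ G K i yᵖ ⟩
  (A + yᵖ) * (h₁₁ + i * h₁) - (G + i * (A + yᵖ)) * (h₁ + i) + (K + i * (G + i * (A + yᵖ)))
    ≡⟨ cong (λ a → a * (h₁₁ + i * h₁) - (G + i * a) * (h₁ + i) + (K + i * (G + i * a))) (H[-p]-suc n p) ⟨
  A′ * (h₁₁ + i * h₁) - (G + i * A′) * (h₁ + i) + (K + i * (G + i * A′))
    ≡⟨ cong (λ g → A′ * (h₁₁ + i * h₁) - g * (h₁ + i) + (K + i * g)) G-step ⟨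
  A′ * (h₁₁ + i * h₁) - C₀ p y * (h₁ + i) + (K + i * C₀ p y)
    ≡⟨ cong (λ k → A′ * (h₁₁ + i * h₁) - C₀ p y * (h₁ + i) + k) (C₀₀-step n p) ⟨
  A′ * (h₁₁ + i * h₁) - C₀ p y * (h₁ + i) + C₀₀ p y
    ≡⟨ cong₂ (λ a b → A′ * a - C₀ p y * b + C₀₀ p y) (H[1,1]-suc n) (H[1]-suc n) ⟨
  A′ * H (suc n) (+ 1 ∷ + 1 ∷ []) - C₀ p y * H (suc n) (+ 1 ∷ []) + C₀₀ p y
    ∎
  where
  y = ℕ→ℚ (suc n)
  i = invℕ (suc n)
  yᵖ = y ^ℚ p
  A = H n (- (+ p) ∷ [])
  A′ = H (suc n) (- (+ p) ∷ [])
  h₁ = H n (+ 1 ∷ [])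
  h₁₁ = H n (+ 1 ∷ + 1 ∷ [])
  G = C₀ p (ℕ→ℚ n)
  K = C₀₀ p (ℕ→ℚ n)
  G-step : C₀ p y ≡ G + i * A′
  G-step = trans (C₀-step n p) (cong (λ f → G + i * f) (sym (H[-p]≡faulhaber p (suc n))))
  telescope : ∀ A h₁₁ h₁ G K i yᵖ → (A * h₁₁ - G * h₁ + K) + yᵖ * h₁₁ ≡
    (A + yᵖ) * (h₁₁ + i * h₁) - (G + i * (A + yᵖ)) * (h₁ + i) + (K + i * (G + i * (A + yᵖ)))
  telescope = solve-∀ ℚ-ring

½ : ℚ
½ = (+ 1) / 2

H[1,1]≡½[H[1]²-H[2]] : ∀ n → H n (+ 1 ∷ + 1 ∷ []) ≡ ½ * (H n (+ 1 ∷ []) * H n (+ 1 ∷ []) - H n (+ 2 ∷ []))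
H[1,1]≡½[H[1]²-H[2]] zero    = refl
H[1,1]≡½[H[1]²-H[2]] (suc n) = begin
  H (suc n) (+ 1 ∷ + 1 ∷ [])
    ≡⟨ H[1,1]-suc n ⟩
  H n (+ 1 ∷ + 1 ∷ []) + i * h₁
    ≡⟨ cong₂ _+_ (H[1,1]≡½[H[1]²-H[2]] n) (sym (ℚ.*-identityˡ (i * h₁))) ⟩
  ½ * (h₁ * h₁ - h₂) + (½ + ½) * (i * h₁)
    ≡⟨ square ½ h₁ h₂ i ⟩
  ½ * ((h₁ + i) * (h₁ + i) - (h₂ + i * i))
    ≡⟨ cong₂ (λ a b → ½ * (a * a - b)) (H[1]-suc n) (H[2]-suc n) ⟨
  ½ * (H (suc n) (+ 1 ∷ []) * H (suc n) (+ 1 ∷ []) - H (suc n) (+ 2 ∷ [])) ∎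
  where
  i = invℕ (suc n)
  h₁ = H n (+ 1 ∷ [])
  h₂ = H n (+ 2 ∷ [])
  -- `½ + ½` computes to `1ℚ`, so ½ can be treated as an opaque ring element.
  square : ∀ h a b i → h * (a * a - b) + (h + h) * (i * a) ≡ h * ((a + i) * (a + i) - (b + i * i))
  square = solve-∀ ℚ-ring

-- The identity also holds for n = 0.
corollary2p3 : (p : ℕ) (n : ℕ) → 1 ≤ n →
  let x = ℕ→ℚ n
      Hmp = H n (- (+ p) ∷ [])
      H1 = H n (+ 1 ∷ [])
  in (H n (- (+ p) ∷ + 1 ∷ + 1 ∷ [])
        ≡ Hmp * H n (+ 1 ∷ + 1 ∷ []) - Cp p (0 ∷ []) x * H1 + Cp p (0 ∷ 0 ∷ []) x)
   × (Hmp * H n (+ 1 ∷ + 1 ∷ []) - Cp p (0 ∷ []) x * H1 + Cp p (0 ∷ 0 ∷ []) x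
        ≡ ((+ 1) / 2) * Hmp * (H1 * H1 - H n (+ 2 ∷ []))
          - Cp p (0 ∷ []) x * H1 + Cp p (0 ∷ 0 ∷ []) x)
corollary2p3 p n _ = first , second
  where
  A = H n (- (+ p) ∷ [])
  h₁ = H n (+ 1 ∷ [])
  c₀ = Cp p (0 ∷ []) (ℕ→ℚ n)
  c₀₀ = Cp p (0 ∷ 0 ∷ []) (ℕ→ℚ n)
  first : H n (- (+ p) ∷ + 1 ∷ + 1 ∷ []) ≡ A * H n (+ 1 ∷ + 1 ∷ []) - c₀ * h₁ + c₀₀
  first = trans (H[-p,1,1]-expansion p n)
    (sym (cong₂ (λ g k → A * H n (+ 1 ∷ + 1 ∷ []) - g * h₁ + k) (Cp[0]≡C₀ p (ℕ→ℚ n)) (Cp[0,0]≡C₀₀ p (ℕ→ℚ n))))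
  reassoc : ∀ A h X → A * (h * X) ≡ h * A * X
  reassoc = solve-∀ ℚ-ring
  second : A * H n (+ 1 ∷ + 1 ∷ []) - c₀ * h₁ + c₀₀ ≡ ½ * A * (h₁ * h₁ - H n (+ 2 ∷ [])) - c₀ * h₁ + c₀₀
  second = cong (λ t → t - c₀ * h₁ + c₀₀)
    (trans (cong (_*_ A) (H[1,1]≡½[H[1]²-H[2]] n)) (reassoc A ½ (h₁ * h₁ - H n (+ 2 ∷ []))))
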